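{- Let $(\mathcal{S}_n)_{n\ge1}$ be the Sierpiński gasket graphs, and for $k\in\{0,1,2,3\}$ let $\alpha_n^k$ denote the largest cardinality of an independent set of $\mathcal{S}_n$ containing exactly $k$ of the three outmost vertices. Then for every integer $n\geq 3$: $$\alpha_{n+1}^0=\max\{3\alpha_n^0,\ \alpha_n^0+2\alpha_n^1-1,\ 2\alpha_n^1+\alpha_n^2-2,\ 3\alpha_n^2-3\},$$ $$\alpha_{n+1}^1=\max\{2\alpha_n^0+\alpha_n^1,\ \alpha_n^0+\alpha_n^1+\alpha_n^2-1,\ 3\alpha_n^1-1,\ 2\alpha_n^1+\alpha_n^3-2,\ \alpha_n^1+2\alpha_n^2-2,\ 2\alpha_n^2+\alpha_n^3-3\},$$ $$\alpha_{n+1}^2=\max\{\alpha_n^0+2\alpha_n^1,\ \alpha_n^0+2\alpha_n^2-1,\ 2\alpha_n^1+\alpha_n^2-1,\ 3\alpha_n^2-2,\ \alpha_n^1+\alpha_n^2+\alpha_n^3-2,\ \alpha_n^2+2\alpha_n^3-3\},$$ $$\alpha_{n+1}^3=\max\{3\alpha_n^1,\ \alpha_n^1+2\alpha_n^2-1,\ 2\alpha_n^2+\alpha_n^3-2,\ 3\alpha_n^3-3\}.$$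
   Context: The Sierpiński gasket graphs $\mathcal{S}_n$, each with three distinguished "outmost" vertices $A_n,B_n,C_n$, are defined recursively: $\mathcal{S}_1$ is a triangle with vertices $A_1,B_1,C_1$. Given $\mathcal{S}_n$, take three disjoint copies $\mathcal{S}_n^{(1)},\mathcal{S}_n^{(2)},\mathcal{S}_n^{(3)}$ with outmost vertices $A_n^{(\theta)},B_n^{(\theta)},C_n^{(\theta)}$; identify $B_n^{(1)}$ with $A_n^{(2)}$, $C_n^{(1)}$ with $A_n^{(3)}$, and $C_n^{(2)}$ with $B_n^{(3)}$; the result is $\mathcal{S}_{n+1}$, with outmost vertices $A_{n+1}=A_n^{(1)}$, $B_{n+1}=B_n^{(2)}$, $C_{n+1}=C_n^{(3)}$. An independent set is a set of pairwise non-adjacent vertices. -}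

module Defs where

open import Data.Nat using (ℕ; zero; suc; _≤_)
open import Data.Fin using (Fin; zero; suc)
open import Data.Empty using (⊥)
open import Data.Unit using (⊤)
open import Data.Sum using (_⊎_; inj₁; inj₂)
open import Data.Product using (Σ; _×_; _,_; ∃)
open import Data.List using (List; length)
open import Data.List.Membership.Propositional using (_∈_)
open import Data.List.Relation.Unary.Unique.Propositional using (Unique)
open import Relation.Binary.PropositionalEquality using (_≡_; _≢_)
open import Relation.Nullary using (¬_)

-- Outmost-vertex labels: zero = A, suc zero = B, suc (suc zero) = C.
Corner : Set
Corner = Fin 3

-- Index 0 is unused junk (S_0 is
-- not defined in the paper); S_1 is a triangle, so it has no inner vertex.
-- Inner vertices of S_{n+1} are: inner vertices of the three copies
-- (copy θ ∈ Fin 3: zero = copy (1), suc zero = copy (2), suc (suc zero) = copy (3)),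
-- plus the three identified vertices (junctions):
--   zero           : B^(1) = A^(2)
--   suc zero       : C^(1) = A^(3)
--   suc (suc zero) : C^(2) = B^(3)
Inner : ℕ → Set
Inner zero = ⊥
Inner (suc zero) = ⊥
Inner (suc (suc n)) = (Fin 3 × Inner (suc n)) ⊎ Fin 3

data Vertex (n : ℕ) : Set where
  outmost : Corner → Vertex n
  inner   : Inner n → Vertex n

emb : (n : ℕ) → Fin 3 → Vertex (suc n) → Vertex (suc (suc n))
emb n θ (inner x) = inner (inj₁ (θ , x))
emb n zero (outmost zero) = outmost zero
emb n zero (outmost (suc zero)) = inner (inj₂ zero)
emb n zero (outmost (suc (suc zero))) = inner (inj₂ (suc zero))
emb n (suc zero) (outmost zero) = inner (inj₂ zero)
emb n (suc zero) (outmost (suc zero)) = outmost (suc zero)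
emb n (suc zero) (outmost (suc (suc zero))) = inner (inj₂ (suc (suc zero)))
emb n (suc (suc zero)) (outmost zero) = inner (inj₂ (suc zero))
emb n (suc (suc zero)) (outmost (suc zero)) = inner (inj₂ (suc (suc zero)))
emb n (suc (suc zero)) (outmost (suc (suc zero))) = outmost (suc (suc zero))

Adj : (n : ℕ) → Vertex n → Vertex n → Set
Adj zero u v = ⊥
Adj (suc zero) (outmost a) (outmost b) = a ≢ b
Adj (suc zero) (outmost a) (inner ())
Adj (suc zero) (inner ()) v
Adj (suc (suc n)) u v =
  Σ (Fin 3) λ θ → Σ (Vertex (suc n)) λ x → Σ (Vertex (suc n)) λ y →
    emb n θ x ≡ u × emb n θ y ≡ v × Adj (suc n) x y

Independent : (n : ℕ) → List (Vertex n) → Set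
Independent n S = Unique S × (∀ u v → u ∈ S → v ∈ S → ¬ Adj n u v)

ContainsExactlyOutmost : (n : ℕ) → ℕ → List (Vertex n) → Set
ContainsExactlyOutmost n k S =
  Σ (List Corner) λ L → Unique L × (∀ c → (outmost c ∈ S → c ∈ L) × (c ∈ L → outmost c ∈ S))
    × length L ≡ k

IsAlpha : (n k m : ℕ) → Set
IsAlpha n k m =
  (Σ (List (Vertex n)) λ S → Independent n S × ContainsExactlyOutmost n k S × length S ≡ m)
  × (∀ (S : List (Vertex n)) → Independent n S → ContainsExactlyOutmost n k S → length S ≤ m)

-- Write α_n^k = α_n^0 + bonus k, with bonus = (0, 1, 1, 2) and α_{n+1}^0 = 3 α_n^0 + 1.  For n ≥ 2
-- these closed forms turn every term of the recurrences into 3 α_n^0 plus a constant, so the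
-- theorem (which in fact holds from n = 2 on) becomes arithmetic.  The closed forms are proved for
-- Boolean vertex selections by induction along the gasket.  Restricting a selection of S_{n+1} to
-- its three copies of S_n counts each selected junction twice, and the corner bonuses of the copies
-- exceed the corner bonus of S_{n+1} by at most 1 plus the number of selected junctions: this gives
-- the upper bound.  Conversely, gluing optimal selections of the copies attains it.  The needed
-- inequalities between bonuses involve only six Booleans and are checked by evaluation.

module Submission where

open import Defs
open import Data.Bool using (Bool; true; false; T; T?; not; _∧_; _∨_)
open import Data.Bool.Properties using (T-∧)
open import Data.Empty using (⊥; ⊥-elim)
open import Data.Fin using (Fin; zero; suc)
import Data.Fin.Properties as Fin
open import Data.List using (List; []; _∷_; _++_; map; length; foldl; allFin; cartesianProduct; filterᵇ)
open import Data.List.Membership.Propositional using (_∈_)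
open import Data.List.Membership.Propositional.Properties
  using (∈-++⁺ˡ; ∈-++⁺ʳ; ∈-map⁺; ∈-map⁻; ∈-filter⁺; ∈-filter⁻; ∈-allFin; ∈-cartesianProduct⁺)
open import Data.List.Membership.Propositional.Properties.WithK using (unique∧set⇒bag)
open import Data.List.Relation.Binary.BagAndSetEquality using (∼bag⇒↭)
open import Data.List.Relation.Binary.Permutation.Propositional.Properties using (↭-length)
open import Data.List.Relation.Unary.AllPairs using ([])
open import Data.List.Relation.Unary.Unique.Propositional using (Unique)
import Data.List.Relation.Unary.Unique.Propositional.Properties as Unique
open import Data.Nat using (ℕ; zero; suc; _+_; _*_; _∸_; _⊔_; _≤_; _≤ᵇ_; z≤n; s≤s)
open import Data.Nat.ListAction using (sum)
open import Data.Nat.Properties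
open import Data.Nat.Tactic.RingSolver using (solve-∀)
open import Data.Product using (Σ; _×_; _,_; proj₁; proj₂)
import Data.Product.Properties as Product
open import Data.Sum using (inj₁; inj₂)
import Data.Sum.Properties as Sum
open import Function using (_∘_; flip; _⇔_; mk⇔; Equivalence)
open import Relation.Binary.Definitions using (DecidableEquality)
open import Relation.Binary.PropositionalEquality using (_≡_; _≢_; refl; sym; trans; cong; cong₂; subst; module ≡-Reasoning)
open import Relation.Nullary using (no)
open import Relation.Nullary.Decidable using (map′; isYes; toWitness; fromWitness)

pattern one = suc zero
pattern two = suc (suc zero)

bit : Bool → ℕ
bit false = 0
bit true  = 1

count : ∀ {A : Set} → (A → Bool) → List A → ℕ
count f []       = 0
count f (x ∷ xs) = bit (f x) + count f xs

module _ {A : Set} where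

  count-++ : ∀ (f : A → Bool) xs ys → count f (xs ++ ys) ≡ count f xs + count f ys
  count-++ f []       ys = refl
  count-++ f (x ∷ xs) ys = trans (cong (bit (f x) +_) (count-++ f xs ys)) (sym (+-assoc (bit (f x)) _ _))

  count-map : ∀ {B : Set} (f : B → Bool) (g : A → B) xs → count f (map g xs) ≡ count (f ∘ g) xs
  count-map f g []       = refl
  count-map f g (x ∷ xs) = cong (bit (f (g x)) +_) (count-map f g xs)

  length-filterᵇ : ∀ (f : A → Bool) xs → length (filterᵇ f xs) ≡ count f xs
  length-filterᵇ f []       = refl
  length-filterᵇ f (x ∷ xs) with f x
  ... | true  = cong suc (length-filterᵇ f xs)
  ... | false = length-filterᵇ f xs

  unique∧set⇒length≡ : ∀ {xs ys : List A} → Unique xs → Unique ys →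
                              (∀ {x} → x ∈ xs ⇔ x ∈ ys) → length xs ≡ length ys
  unique∧set⇒length≡ u v same = ↭-length (∼bag⇒↭ (unique∧set⇒bag u v same))

Σ₃ : (Fin 3 → ℕ) → ℕ
Σ₃ g = g zero + g one + g two

count₃ : (Fin 3 → Bool) → ℕ
count₃ p = Σ₃ (bit ∘ p)

corners₃ : Bool → Bool → Bool → Fin 3 → Bool
corners₃ a b c zero = a
corners₃ a b c one  = b
corners₃ a b c two  = c

sum-allFin3 : (g : Fin 3 → ℕ) → sum (map g (allFin 3)) ≡ Σ₃ g
sum-allFin3 g = trans (cong (g zero +_) (cong (g one +_) (+-identityʳ (g two)))) (sym (+-assoc (g zero) (g one) (g two)))

count-allFin3 : (p : Fin 3 → Bool) → count p (allFin 3) ≡ count₃ p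
count-allFin3 p = sum-allFin3 (bit ∘ p)

count-cartesianProduct : ∀ {A B : Set} (h : A × B → Bool) xs ys →
                         count h (cartesianProduct xs ys) ≡ sum (map (λ x → count (h ∘ (x ,_)) ys) xs)
count-cartesianProduct h []       ys = refl
count-cartesianProduct h (x ∷ xs) ys =
  trans (count-++ h (map (x ,_) ys) (cartesianProduct xs ys))
        (cong₂ _+_ (count-map h (x ,_) ys) (count-cartesianProduct h xs ys))

-- Inequalities in Boolean variables, decided by evaluating all cases

Inequality : ℕ → Set
Inequality zero    = ℕ × ℕ
Inequality (suc n) = Bool → Inequality n

Holds : ∀ n → Inequality n → Set
Holds zero    (l , r) = l ≤ r
Holds (suc n) P       = ∀ b → Holds n (P b)

check : ∀ n → Inequality n → Bool
check zero    (l , r) = l ≤ᵇ r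
check (suc n) P       = check n (P false) ∧ check n (P true)

check-sound : ∀ n P → T (check n P) → Holds n P
check-sound zero    (l , r) t       = ≤ᵇ⇒≤ l r t
check-sound (suc n) P       t false = check-sound n (P false) (proj₁ (Equivalence.to T-∧ t))
check-sound (suc n) P       t true  = check-sound n (P true)  (proj₂ (Equivalence.to T-∧ t))

decide : ∀ n {P} {_ : T (check n P)} → Holds n P
decide n {P} {t} = check-sound n P t

pattern junction i = inner (inj₂ i)

_≟ᴵ_ : ∀ {n} → DecidableEquality (Inner n)
_≟ᴵ_ {suc (suc n)} = Sum.≡-dec (Product.≡-dec Fin._≟_ _≟ᴵ_) Fin._≟_

_≟ⱽ_ : ∀ {n} → DecidableEquality (Vertex n)
outmost a ≟ⱽ outmost b = map′ (cong outmost) (λ { refl → refl }) (a Fin.≟ b)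
outmost a ≟ⱽ inner y   = no λ ()
inner x   ≟ⱽ outmost b = no λ ()
inner x   ≟ⱽ inner y   = map′ (cong inner) (λ { refl → refl }) (x ≟ᴵ y)

inners : (n : ℕ) → List (Inner n)
inners zero          = []
inners (suc zero)    = []
inners (suc (suc n)) = map inj₁ (cartesianProduct (allFin 3) (inners (suc n))) ++ map inj₂ (allFin 3)

vertices : (n : ℕ) → List (Vertex n)
vertices n = map outmost (allFin 3) ++ map inner (inners n)

∈-inners : ∀ {n} (x : Inner n) → x ∈ inners n
∈-inners {suc (suc n)} (inj₁ (θ , y)) =
  ∈-++⁺ˡ (∈-map⁺ inj₁ (∈-cartesianProduct⁺ (∈-allFin θ) (∈-inners y)))
∈-inners {suc (suc n)} (inj₂ i) = ∈-++⁺ʳ _ (∈-map⁺ inj₂ (∈-allFin i))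

∈-vertices : ∀ {n} (v : Vertex n) → v ∈ vertices n
∈-vertices (outmost c) = ∈-++⁺ˡ (∈-map⁺ outmost (∈-allFin c))
∈-vertices (inner x)   = ∈-++⁺ʳ _ (∈-map⁺ inner (∈-inners x))

module _ {A B C : Set} {f : A → C} {g : B → C} where

  map-disjoint : (∀ x y → f x ≢ g y) → ∀ xs ys {z} → z ∈ map f xs → z ∈ map g ys → ⊥
  map-disjoint f≢g xs ys z∈fxs z∈gys with ∈-map⁻ f z∈fxs | ∈-map⁻ g z∈gys
  ... | x , _ , refl | y , _ , fx≡gy = f≢g x y fx≡gy

inners-unique : ∀ n → Unique (inners n)
inners-unique zero          = []
inners-unique (suc zero)    = []
inners-unique (suc (suc n)) =
  Unique.++⁺ (Unique.map⁺ {f = inj₁} Sum.inj₁-injective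
               (Unique.cartesianProduct⁺ (Unique.allFin⁺ 3) (inners-unique (suc n))))
             (Unique.map⁺ {f = inj₂} Sum.inj₂-injective (Unique.allFin⁺ 3))
             (λ (p , q) → map-disjoint {f = inj₁} {g = inj₂} (λ _ _ ()) _ _ p q)

vertices-unique : ∀ n → Unique (vertices n)
vertices-unique n =
  Unique.++⁺ (Unique.map⁺ {f = outmost} (λ { refl → refl }) (Unique.allFin⁺ 3))
             (Unique.map⁺ {f = inner} (λ { refl → refl }) (inners-unique n))
             (λ (p , q) → map-disjoint {f = outmost} {g = inner} (λ _ _ ()) _ _ p q)

Selection : ℕ → Set
Selection n = Vertex n → Bool

IsIndependent : ∀ {n} → Selection n → Set
IsIndependent {n} f = ∀ u v → Adj n u v → T (f u) → T (f v) → ⊥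

size : ∀ {n} → Selection n → ℕ
size {n} f = count f (vertices n)

restrict : ∀ {n} → Fin 3 → Selection (suc (suc n)) → Selection (suc n)
restrict {n} θ f = f ∘ emb n θ

restrict-independent : ∀ {n} {f : Selection (suc (suc n))} θ → IsIndependent f → IsIndependent (restrict θ f)
restrict-independent θ ind x y adj = ind _ _ (θ , x , y , refl , refl , adj)

restrictions-independent⇒independent : ∀ {n} {f : Selection (suc (suc n))} →
                                  (∀ θ → IsIndependent (restrict θ f)) → IsIndependent f
restrictions-independent⇒independent ind _ _ (θ , x , y , refl , refl , adj) = ind θ x y adj

size-vertices : ∀ {n} (f : Selection n) → size f ≡ count₃ (f ∘ outmost) + count (f ∘ inner) (inners n)
size-vertices {n} f = begin
  count f (map outmost (allFin 3) ++ map inner (inners n))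
    ≡⟨ count-++ f (map outmost (allFin 3)) (map inner (inners n)) ⟩
  count f (map outmost (allFin 3)) + count f (map inner (inners n))
    ≡⟨ cong₂ _+_ (trans (count-map f outmost (allFin 3)) (count-allFin3 (f ∘ outmost)))
                 (count-map f inner (inners n)) ⟩
  count₃ (f ∘ outmost) + count (f ∘ inner) (inners n) ∎
  where open ≡-Reasoning

count-inners : ∀ {n} (g : Inner (suc (suc n)) → Bool) →
               count g (inners (suc (suc n)))
               ≡ Σ₃ (λ θ → count (λ x → g (inj₁ (θ , x))) (inners (suc n))) + count₃ (g ∘ inj₂)
count-inners {n} g = begin
  count g (map inj₁ P ++ map inj₂ (allFin 3))
    ≡⟨ count-++ g (map inj₁ P) (map inj₂ (allFin 3)) ⟩
  count g (map inj₁ P) + count g (map inj₂ (allFin 3))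
    ≡⟨ cong₂ _+_ (trans (count-map g inj₁ P) (count-cartesianProduct (g ∘ inj₁) (allFin 3) I))
                 (trans (count-map g inj₂ (allFin 3)) (count-allFin3 (g ∘ inj₂))) ⟩
  sum (map (λ θ → count (λ x → g (inj₁ (θ , x))) I) (allFin 3)) + count₃ (g ∘ inj₂)
    ≡⟨ cong (_+ count₃ (g ∘ inj₂)) (sum-allFin3 (λ θ → count (λ x → g (inj₁ (θ , x))) I)) ⟩
  Σ₃ (λ θ → count (λ x → g (inj₁ (θ , x))) I) + count₃ (g ∘ inj₂) ∎
  where
  open ≡-Reasoning
  I = inners (suc n)
  P = cartesianProduct (allFin 3) I

junctions-counted-twice : ∀ a b c j₀ j₁ j₂ i₀ i₁ i₂ →
  a + b + c + ((i₀ + i₁ + i₂) + (j₀ + j₁ + j₂)) + (j₀ + j₁ + j₂)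
  ≡ (a + j₀ + j₁ + i₀) + (j₀ + b + j₂ + i₁) + (j₁ + j₂ + c + i₂)
junctions-counted-twice = solve-∀

size-split : ∀ {n} (f : Selection (suc (suc n))) →
             size f + count₃ (f ∘ junction) ≡ Σ₃ (λ θ → size (restrict θ f))
size-split {n} f = begin
  size f + J
    ≡⟨ cong (_+ J) (trans (size-vertices f) (cong (count₃ (f ∘ outmost) +_) (count-inners (f ∘ inner)))) ⟩
  count₃ (f ∘ outmost) + (Σ₃ copy + J) + J
    ≡⟨ junctions-counted-twice (bit (f (outmost zero))) (bit (f (outmost one))) (bit (f (outmost two)))
                               (bit (f (junction zero))) (bit (f (junction one))) (bit (f (junction two)))
                               (copy zero) (copy one) (copy two) ⟩
  Σ₃ (λ θ → count₃ (restrict θ f ∘ outmost) + copy θ)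
    ≡⟨ cong₂ _+_ (cong₂ _+_ (sym (size-vertices (restrict zero f))) (sym (size-vertices (restrict one f))))
                 (sym (size-vertices (restrict two f))) ⟩
  Σ₃ (λ θ → size (restrict θ f)) ∎
  where
  open ≡-Reasoning
  J = count₃ (f ∘ junction)
  copy : Fin 3 → ℕ
  copy θ = count (λ x → f (inner (inj₁ (θ , x)))) (inners (suc n))

-- The upper bound

-- α⁰ n is α_n^0; the value at n = 0 is junk, as S_0 does not exist.
α⁰ : ℕ → ℕ
α⁰ zero          = 0
α⁰ (suc zero)    = 0
α⁰ (suc (suc n)) = 3 * α⁰ (suc n) + 1

bonus : ℕ → ℕ
bonus 0 = 0
bonus 1 = 1
bonus 2 = 1
bonus (suc (suc (suc _))) = 2

≤1⇒≤bonus : ∀ {k} → k ≤ 1 → k ≤ bonus k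
≤1⇒≤bonus z≤n       = z≤n
≤1⇒≤bonus (s≤s z≤n) = s≤s z≤n

bonus≤id : ∀ k → bonus k ≤ k
bonus≤id 0 = z≤n
bonus≤id 1 = s≤s z≤n
bonus≤id 2 = s≤s z≤n
bonus≤id (suc (suc (suc k))) = s≤s (s≤s z≤n)

copyCorners : (Fin 3 → Bool) → (Fin 3 → Bool) → Fin 3 → Fin 3 → Bool
copyCorners p j zero = corners₃ (p zero) (j zero) (j one)
copyCorners p j one  = corners₃ (j zero) (p one) (j two)
copyCorners p j two  = corners₃ (j one) (j two) (p two)

bonus-exchange : ∀ a b c j₀ j₁ j₂ → let p = corners₃ a b c ; j = corners₃ j₀ j₁ j₂ in
                 Σ₃ (λ θ → bonus (count₃ (copyCorners p j θ))) ≤ 1 + bonus (count₃ p) + count₃ j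
bonus-exchange = decide 6

at-most-one : ∀ x y z → (T x → T y → ⊥) → (T x → T z → ⊥) → (T y → T z → ⊥) →
              count₃ (corners₃ x y z) ≤ 1
at-most-one true  true  _     xy _  _  = ⊥-elim (xy _ _)
at-most-one true  false true  _  xz _  = ⊥-elim (xz _ _)
at-most-one false true  true  _  _  yz = ⊥-elim (yz _ _)
at-most-one true  false false _  _  _  = ≤-refl
at-most-one false true  false _  _  _  = ≤-refl
at-most-one false false true  _  _  _  = ≤-refl
at-most-one false false false _  _  _  = z≤n

exclusive : ∀ x y z → count₃ (corners₃ x y z) ≤ 1 →
            (T x → T y → ⊥) × (T x → T z → ⊥) × (T y → T z → ⊥)
exclusive true  true  _     (s≤s ())
exclusive true  false true  (s≤s ())
exclusive false true  true  (s≤s ())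
exclusive true  false false _ = (λ _ ()) , (λ _ ()) , (λ ())
exclusive false true  false _ = (λ ()) , (λ ()) , (λ _ ())
exclusive false false true  _ = (λ ()) , (λ ()) , (λ ())
exclusive false false false _ = (λ ()) , (λ ()) , (λ ())

triangle-independent⇔≤1 : (f : Selection 1) → IsIndependent f ⇔ count₃ (f ∘ outmost) ≤ 1
triangle-independent⇔≤1 f = mk⇔
  (λ ind → at-most-one (f (outmost zero)) (f (outmost one)) (f (outmost two))
             (ind (outmost zero) (outmost one) (λ ()))
             (ind (outmost zero) (outmost two) (λ ()))
             (ind (outmost one) (outmost two) (λ ())))
  (λ ≤1 → let (ab , ac , bc) = exclusive (f (outmost zero)) (f (outmost one)) (f (outmost two)) ≤1 in
    λ where
      (outmost zero) (outmost one)  _ → ab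
      (outmost zero) (outmost two)  _ → ac
      (outmost one)  (outmost two)  _ → bc
      (outmost one)  (outmost zero) _ → flip ab
      (outmost two)  (outmost zero) _ → flip ac
      (outmost two)  (outmost one)  _ → flip bc
      (outmost zero) (outmost zero) a≢a → ⊥-elim (a≢a refl)
      (outmost one)  (outmost one)  a≢a → ⊥-elim (a≢a refl)
      (outmost two)  (outmost two)  a≢a → ⊥-elim (a≢a refl))

Σ₃-mono-≤ : ∀ {g h : Fin 3 → ℕ} → (∀ θ → g θ ≤ h θ) → Σ₃ g ≤ Σ₃ h
Σ₃-mono-≤ g≤h = +-mono-≤ (+-mono-≤ (g≤h zero) (g≤h one)) (g≤h two)

Σ₃-shift : ∀ x (g : Fin 3 → ℕ) → Σ₃ (λ θ → x + g θ) ≡ 3 * x + Σ₃ g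
Σ₃-shift x g = shift x (g zero) (g one) (g two)
  where
  shift : ∀ x a b c → x + a + (x + b) + (x + c) ≡ 3 * x + (a + b + c)
  shift = solve-∀

regroup : ∀ y b J → y + (1 + b + J) ≡ y + 1 + b + J
regroup = solve-∀

module _ {s J x b : ℕ} (sθ bθ : Fin 3 → ℕ) (split : s + J ≡ Σ₃ sθ) where

  cancel-junctions-≤ : (∀ θ → sθ θ ≤ x + bθ θ) → Σ₃ bθ ≤ 1 + b + J → s ≤ 3 * x + 1 + b
  cancel-junctions-≤ copies exchange = +-cancelʳ-≤ J s (3 * x + 1 + b) (begin
    s + J                ≡⟨ split ⟩
    Σ₃ sθ                ≤⟨ Σ₃-mono-≤ copies ⟩
    Σ₃ (λ θ → x + bθ θ)  ≡⟨ Σ₃-shift x bθ ⟩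
    3 * x + Σ₃ bθ        ≤⟨ +-monoʳ-≤ (3 * x) exchange ⟩
    3 * x + (1 + b + J)  ≡⟨ regroup (3 * x) b J ⟩
    3 * x + 1 + b + J    ∎)
    where open ≤-Reasoning

  cancel-junctions-≥ : (∀ θ → x + bθ θ ≤ sθ θ) → 1 + b + J ≤ Σ₃ bθ → 3 * x + 1 + b ≤ s
  cancel-junctions-≥ copies exchange = +-cancelʳ-≤ J (3 * x + 1 + b) s (begin
    3 * x + 1 + b + J    ≡⟨ regroup (3 * x) b J ⟨
    3 * x + (1 + b + J)  ≤⟨ +-monoʳ-≤ (3 * x) exchange ⟩
    3 * x + Σ₃ bθ        ≡⟨ Σ₃-shift x bθ ⟨
    Σ₃ (λ θ → x + bθ θ)  ≤⟨ Σ₃-mono-≤ copies ⟩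
    Σ₃ sθ                ≡⟨ split ⟨
    s + J                ∎)
    where open ≤-Reasoning

size-bound : ∀ n (f : Selection (suc n)) → IsIndependent f → size f ≤ α⁰ (suc n) + bonus (count₃ (f ∘ outmost))
size-bound zero f ind = begin
  size f                    ≡⟨ size-vertices f ⟩
  count₃ (f ∘ outmost) + 0  ≡⟨ +-identityʳ _ ⟩
  count₃ (f ∘ outmost)      ≤⟨ ≤1⇒≤bonus (Equivalence.to (triangle-independent⇔≤1 f) ind) ⟩
  bonus (count₃ (f ∘ outmost)) ∎
  where open ≤-Reasoning
size-bound (suc n) f ind =
  -- the corners of restrict θ f compute to copyCorners (f ∘ outmost) (f ∘ junction) θ
  cancel-junctions-≤ (λ θ → size (restrict θ f)) (λ θ → bonus (count₃ (restrict θ f ∘ outmost))) (size-split f)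
    (λ θ → size-bound n (restrict θ f) (restrict-independent θ ind))
    (bonus-exchange (f (outmost zero)) (f (outmost one)) (f (outmost two))
                    (f (junction zero)) (f (junction one)) (f (junction two)))

-- Selections attaining the bound

record Realisation (n : ℕ) (p : Fin 3 → Bool) : Set where
  field
    selection   : Selection n
    independent : IsIndependent selection
    corners     : ∀ c → selection (outmost c) ≡ p c
    large       : α⁰ n + bonus (count₃ p) ≤ size selection

open Realisation

count-cong : ∀ {A : Set} {f g : A → Bool} → (∀ x → f x ≡ g x) → ∀ xs → count f xs ≡ count g xs
count-cong f≗g []       = refl
count-cong f≗g (x ∷ xs) = cong₂ (λ b n → bit b + n) (f≗g x) (count-cong f≗g xs)

triangle : (Fin 3 → Bool) → Selection 1
triangle p (outmost c) = p c

realisable-triangle : ∀ p → count₃ p ≤ 1 → Realisation 1 p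
realisable-triangle p ≤1 = record
  { selection   = triangle p
  ; independent = Equivalence.from (triangle-independent⇔≤1 (triangle p)) ≤1
  ; corners     = λ c → refl
  ; large       = ≤-trans (bonus≤id (count₃ p))
                          (≤-reflexive (sym (trans (size-vertices (triangle p)) (+-identityʳ (count₃ p)))))
  }

glue : ∀ {n} → (Fin 3 → Bool) → (Fin 3 → Bool) → (Fin 3 → Selection (suc n)) → Selection (suc (suc n))
glue p j fs (outmost c)            = p c
glue p j fs (inner (inj₁ (θ , x))) = fs θ (inner x)
glue p j fs (junction i)           = j i

glue-copyCorners : ∀ {n} p j (fs : Fin 3 → Selection (suc n)) θ c →
                   restrict θ (glue p j fs) (outmost c) ≡ copyCorners p j θ c
glue-copyCorners p j fs zero zero = refl
glue-copyCorners p j fs zero one  = refl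
glue-copyCorners p j fs zero two  = refl
glue-copyCorners p j fs one  zero = refl
glue-copyCorners p j fs one  one  = refl
glue-copyCorners p j fs one  two  = refl
glue-copyCorners p j fs two  zero = refl
glue-copyCorners p j fs two  one  = refl
glue-copyCorners p j fs two  two  = refl

realisable-glue : ∀ {n} p j → (∀ θ → Realisation (suc n) (copyCorners p j θ)) →
                  1 + bonus (count₃ p) + count₃ j ≤ Σ₃ (λ θ → bonus (count₃ (copyCorners p j θ))) →
                  Realisation (suc (suc n)) p
realisable-glue {n} p j copy gain = record
  { selection   = g
  ; independent = restrictions-independent⇒independent λ θ u v adj gu gv →
      independent (copy θ) u v adj (subst T (restrict-glue θ u) gu) (subst T (restrict-glue θ v) gv)
  ; corners     = λ c → refl
  ; large       = cancel-junctions-≥ {x = α⁰ (suc n)} {b = bonus (count₃ p)}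
                    (λ θ → size (restrict θ g)) (λ θ → bonus (count₃ (copyCorners p j θ)))
                    (size-split g) copy-large gain
  }
  where
  g = glue p j (selection ∘ copy)
  restrict-glue : ∀ θ x → restrict θ g x ≡ selection (copy θ) x
  restrict-glue θ (inner x)   = refl
  restrict-glue θ (outmost c) = trans (glue-copyCorners p j (selection ∘ copy) θ c) (sym (corners (copy θ) c))
  copy-large : ∀ θ → α⁰ (suc n) + bonus (count₃ (copyCorners p j θ)) ≤ size (restrict θ g)
  copy-large θ = ≤-trans (large (copy θ))
                         (≤-reflexive (count-cong (λ x → sym (restrict-glue θ x)) (vertices (suc n))))

-- No junction if two or more corners are selected; otherwise one junction sharing no copy with them.
junctionsFor : (Fin 3 → Bool) → Fin 3 → Bool
junctionsFor p zero = not (p zero ∨ p one)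
junctionsFor p one  = p one ∧ not (p zero ∨ p two)
junctionsFor p two  = p zero ∧ not (p one ∨ p two)

junctionsFor-copy-≤1 : ∀ θ a b c → let p = corners₃ a b c in count₃ (copyCorners p (junctionsFor p) θ) ≤ 1
junctionsFor-copy-≤1 zero = decide 3
junctionsFor-copy-≤1 one  = decide 3
junctionsFor-copy-≤1 two  = decide 3

junctionsFor-gain : ∀ a b c → let p = corners₃ a b c ; j = junctionsFor p in
                    1 + bonus (count₃ p) + count₃ j ≤ Σ₃ (λ θ → bonus (count₃ (copyCorners p j θ)))
junctionsFor-gain = decide 3

realisable-step : ∀ {n} → (∀ p → count₃ p ≤ 1 → Realisation (suc n) p) → ∀ p → Realisation (suc (suc n)) p
realisable-step {n} small p = realisable-glue p (junctionsFor p) copy (junctionsFor-gain (p zero) (p one) (p two))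
  where
  copy : ∀ θ → Realisation (suc n) (copyCorners p (junctionsFor p) θ)
  copy zero = small _ (junctionsFor-copy-≤1 zero (p zero) (p one) (p two))
  copy one  = small _ (junctionsFor-copy-≤1 one  (p zero) (p one) (p two))
  copy two  = small _ (junctionsFor-copy-≤1 two  (p zero) (p one) (p two))

realisable : ∀ n p → Realisation (suc (suc n)) p
realisable zero    = realisable-step realisable-triangle
realisable (suc n) = realisable-step (λ p _ → realisable n p)

module _ {A : Set} {xs : List A} (∈-xs : ∀ x → x ∈ xs) (f : A → Bool) where

  ∈-filterᵇ : ∀ {x} → x ∈ filterᵇ f xs ⇔ T (f x)
  ∈-filterᵇ {x} = mk⇔ (proj₂ ∘ ∈-filter⁻ (T? ∘ f) {xs = xs}) (∈-filter⁺ (T? ∘ f) (∈-xs x))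

  unique∧⇔⇒length≡count : Unique xs → ∀ {S} → Unique S → (∀ {x} → x ∈ S ⇔ T (f x)) → length S ≡ count f xs
  unique∧⇔⇒length≡count xs-unique S-unique S⇔f = trans
    (unique∧set⇒length≡ S-unique (Unique.filter⁺ (T? ∘ f) xs-unique)
      (mk⇔ (Equivalence.from ∈-filterᵇ ∘ Equivalence.to S⇔f) (Equivalence.from S⇔f ∘ Equivalence.to ∈-filterᵇ)))
    (length-filterᵇ f xs)

module _ {n : ℕ} where

  open import Data.List.Membership.DecPropositional (_≟ⱽ_ {n}) using (_∈?_)

  members : Selection n → List (Vertex n)
  members f = filterᵇ f (vertices n)

  ∈-members : ∀ f {v} → v ∈ members f ⇔ T (f v)
  ∈-members = ∈-filterᵇ ∈-vertices

  indicator : List (Vertex n) → Selection n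
  indicator S v = isYes (v ∈? S)

  ∈-indicator : ∀ {S v} → v ∈ S ⇔ T (indicator S v)
  ∈-indicator = mk⇔ fromWitness toWitness

  outmost-count : ∀ {k S} {f : Selection n} → (∀ {v} → v ∈ S ⇔ T (f v)) →
                  ContainsExactlyOutmost n k S → k ≡ count₃ (f ∘ outmost)
  outmost-count {f = f} S⇔f (L , L-unique , L⇔S , refl) =
    trans (unique∧⇔⇒length≡count ∈-allFin (f ∘ outmost) (Unique.allFin⁺ 3) L-unique
            (mk⇔ (Equivalence.to S⇔f ∘ proj₂ (L⇔S _)) (proj₁ (L⇔S _) ∘ Equivalence.from S⇔f)))
          (count-allFin3 (f ∘ outmost))

  members-independent : ∀ {f} → IsIndependent f → Independent n (members f)
  members-independent {f} ind =
    Unique.filter⁺ (T? ∘ f) (vertices-unique n) ,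
    λ u v u∈ v∈ adj → ind u v adj (Equivalence.to (∈-members f) u∈) (Equivalence.to (∈-members f) v∈)

  members-outmost : ∀ f → ContainsExactlyOutmost n (count₃ (f ∘ outmost)) (members f)
  members-outmost f =
    filterᵇ (f ∘ outmost) (allFin 3) ,
    Unique.filter⁺ (T? ∘ f ∘ outmost) (Unique.allFin⁺ 3) ,
    (λ c → (Equivalence.from (∈-filterᵇ ∈-allFin (f ∘ outmost)) ∘ Equivalence.to (∈-members f))
         , (Equivalence.from (∈-members f) ∘ Equivalence.to (∈-filterᵇ ∈-allFin (f ∘ outmost)))) ,
    trans (length-filterᵇ (f ∘ outmost) (allFin 3)) (count-allFin3 (f ∘ outmost))

  length-indicator : ∀ {S} → Unique S → length S ≡ size (indicator S)
  length-indicator {S} S-unique = unique∧⇔⇒length≡count ∈-vertices (indicator S) (vertices-unique n) S-unique ∈-indicator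

  indicator-independent : ∀ {S} → Independent n S → IsIndependent (indicator S)
  indicator-independent (_ , ind) u v adj u∈ v∈ =
    ind u v (Equivalence.from ∈-indicator u∈) (Equivalence.from ∈-indicator v∈) adj

isAlpha-intro : ∀ {n k m} →
                (Σ (List (Vertex n)) λ S → Independent n S × ContainsExactlyOutmost n k S × m ≤ length S) →
                (∀ S → Independent n S → ContainsExactlyOutmost n k S → length S ≤ m) →
                IsAlpha n k m
isAlpha-intro (S , ind , outer , m≤) bound = (S , ind , outer , ≤-antisym (bound S ind outer) m≤) , bound

IsAlpha-unique : ∀ {n k m m′} → IsAlpha n k m → IsAlpha n k m′ → m ≡ m′
IsAlpha-unique ((S , ind , outer , refl) , bound) ((S′ , ind′ , outer′ , refl) , bound′) =
  ≤-antisym (bound′ S ind outer) (bound S′ ind′ outer′)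

alpha-bound : ∀ n {k} S → Independent (suc n) S → ContainsExactlyOutmost (suc n) k S →
              length S ≤ α⁰ (suc n) + bonus k
alpha-bound n S ind outer
  rewrite length-indicator (proj₁ ind) | outmost-count ∈-indicator outer =
  size-bound n (indicator S) (indicator-independent ind)

alpha-value : ∀ n p → IsAlpha (suc (suc n)) (count₃ p) (α⁰ (suc (suc n)) + bonus (count₃ p))
alpha-value n p = isAlpha-intro
  ( members f
  , members-independent (independent r)
  , subst (λ k → ContainsExactlyOutmost _ k (members f)) corners-f (members-outmost f)
  , ≤-trans (large r) (≤-reflexive (sym (length-filterᵇ f (vertices (suc (suc n))))))
  )
  (alpha-bound (suc n))
  where
  r = realisable n p
  f = selection r
  corners-f : count₃ (f ∘ outmost) ≡ count₃ p
  corners-f = cong₂ _+_ (cong₂ _+_ (cong bit (corners r zero)) (cong bit (corners r one))) (cong bit (corners r two))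

triple-shift : ∀ x p → 3 * (x + p) ≡ 3 * x + 3 * p
triple-shift = solve-∀

single+double-shift : ∀ x p q → x + p + 2 * (x + q) ≡ 3 * x + (p + 2 * q)
single+double-shift = solve-∀

double+single-shift : ∀ x p q → 2 * (x + p) + (x + q) ≡ 3 * x + (2 * p + q)
double+single-shift = solve-∀

single+single+single-shift : ∀ x p q r → x + p + (x + q) + (x + r) ≡ 3 * x + (p + q + r)
single+single+single-shift = solve-∀

∸-shift : ∀ y c {t s} → t ≡ y + s → {T (c ≤ᵇ s)} → t ∸ c ≡ y + (s ∸ c)
∸-shift y c {s = s} refl {c≤s} = +-∸-assoc y (≤ᵇ⇒≤ c s c≤s)

⊔-shift : ∀ y k ks → foldl _⊔_ (y + k) (map (y +_) ks) ≡ y + foldl _⊔_ k ks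
⊔-shift y k []        = refl
⊔-shift y k (k′ ∷ ks) = trans (cong (λ m → foldl _⊔_ m (map (y +_) ks)) (sym (+-distribˡ-⊔ y k k′))) (⊔-shift y (k ⊔ k′) ks)

recurrences : ∀ x {a0 a1 a2 a3 b0 b1 b2 b3} →
    a0 ≡ x + 0 → a1 ≡ x + 1 → a2 ≡ x + 1 → a3 ≡ x + 2 →
    b0 ≡ 3 * x + 1 + 0 → b1 ≡ 3 * x + 1 + 1 → b2 ≡ 3 * x + 1 + 1 → b3 ≡ 3 * x + 1 + 2 →
    (b0 ≡ (3 * a0) ⊔ (a0 + 2 * a1 ∸ 1) ⊔ (2 * a1 + a2 ∸ 2) ⊔ (3 * a2 ∸ 3))
    × (b1 ≡ (2 * a0 + a1) ⊔ (a0 + a1 + a2 ∸ 1) ⊔ (3 * a1 ∸ 1) ⊔ (2 * a1 + a3 ∸ 2) ⊔ (a1 + 2 * a2 ∸ 2) ⊔ (2 * a2 + a3 ∸ 3))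
    × (b2 ≡ (a0 + 2 * a1) ⊔ (a0 + 2 * a2 ∸ 1) ⊔ (2 * a1 + a2 ∸ 1) ⊔ (3 * a2 ∸ 2) ⊔ (a1 + a2 + a3 ∸ 2) ⊔ (a2 + 2 * a3 ∸ 3))
    × (b3 ≡ (3 * a1) ⊔ (a1 + 2 * a2 ∸ 1) ⊔ (2 * a2 + a3 ∸ 2) ⊔ (3 * a3 ∸ 3))
recurrences x refl refl refl refl refl refl refl refl =
  trans (+-assoc y 1 0) (sym (trans
    (cong₂ _⊔_ (cong₂ _⊔_ (cong₂ _⊔_
      (triple-shift x 0)
      (∸-shift y 1 (single+double-shift x 0 1)))
      (∸-shift y 2 (double+single-shift x 1 1)))
      (∸-shift y 3 (triple-shift x 1)))
    (⊔-shift y 0 (1 ∷ 1 ∷ 0 ∷ [])))) ,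
  trans (+-assoc y 1 1) (sym (trans
    (cong₂ _⊔_ (cong₂ _⊔_ (cong₂ _⊔_ (cong₂ _⊔_ (cong₂ _⊔_
      (double+single-shift x 0 1)
      (∸-shift y 1 (single+single+single-shift x 0 1 1)))
      (∸-shift y 1 (triple-shift x 1)))
      (∸-shift y 2 (double+single-shift x 1 2)))
      (∸-shift y 2 (single+double-shift x 1 1)))
      (∸-shift y 3 (double+single-shift x 1 2)))
    (⊔-shift y 1 (1 ∷ 2 ∷ 2 ∷ 1 ∷ 1 ∷ [])))) ,
  trans (+-assoc y 1 1) (sym (trans
    (cong₂ _⊔_ (cong₂ _⊔_ (cong₂ _⊔_ (cong₂ _⊔_ (cong₂ _⊔_
      (single+double-shift x 0 1)
      (∸-shift y 1 (single+double-shift x 0 1)))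
      (∸-shift y 1 (double+single-shift x 1 1)))
      (∸-shift y 2 (triple-shift x 1)))
      (∸-shift y 2 (single+single+single-shift x 1 1 2)))
      (∸-shift y 3 (single+double-shift x 1 2)))
    (⊔-shift y 2 (1 ∷ 2 ∷ 1 ∷ 2 ∷ 2 ∷ [])))) ,
  trans (+-assoc y 1 2) (sym (trans
    (cong₂ _⊔_ (cong₂ _⊔_ (cong₂ _⊔_
      (triple-shift x 1)
      (∸-shift y 1 (single+double-shift x 1 1)))
      (∸-shift y 2 (double+single-shift x 1 2)))
      (∸-shift y 3 (triple-shift x 2)))
    (⊔-shift y 3 (2 ∷ 2 ∷ 3 ∷ []))))
  where y = 3 * x

alpha-formula : ∀ n p {m} → IsAlpha (suc (suc n)) (count₃ p) m → m ≡ α⁰ (suc (suc n)) + bonus (count₃ p)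
alpha-formula n p h = IsAlpha-unique h (alpha-value n p)

mainTheorem8 : ∀ (n : ℕ) → 3 ≤ n →
    ∀ (a0 a1 a2 a3 b0 b1 b2 b3 : ℕ) →
    IsAlpha n 0 a0 → IsAlpha n 1 a1 → IsAlpha n 2 a2 → IsAlpha n 3 a3 →
    IsAlpha (ℕ.suc n) 0 b0 → IsAlpha (ℕ.suc n) 1 b1 → IsAlpha (ℕ.suc n) 2 b2 → IsAlpha (ℕ.suc n) 3 b3 →
    (b0 ≡ (3 * a0) ⊔ (a0 + 2 * a1 ∸ 1) ⊔ (2 * a1 + a2 ∸ 2) ⊔ (3 * a2 ∸ 3))
    × (b1 ≡ (2 * a0 + a1) ⊔ (a0 + a1 + a2 ∸ 1) ⊔ (3 * a1 ∸ 1) ⊔ (2 * a1 + a3 ∸ 2) ⊔ (a1 + 2 * a2 ∸ 2) ⊔ (2 * a2 + a3 ∸ 3))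
    × (b2 ≡ (a0 + 2 * a1) ⊔ (a0 + 2 * a2 ∸ 1) ⊔ (2 * a1 + a2 ∸ 1) ⊔ (3 * a2 ∸ 2) ⊔ (a1 + a2 + a3 ∸ 2) ⊔ (a2 + 2 * a3 ∸ 3))
    × (b3 ≡ (3 * a1) ⊔ (a1 + 2 * a2 ∸ 1) ⊔ (2 * a2 + a3 ∸ 2) ⊔ (3 * a3 ∸ 3))
mainTheorem8 (suc (suc n)) (s≤s (s≤s _)) a0 a1 a2 a3 b0 b1 b2 b3 h0 h1 h2 h3 g0 g1 g2 g3 =
  recurrences (α⁰ (suc (suc n)))
    (alpha-formula n none h0) (alpha-formula n A h1) (alpha-formula n AB h2) (alpha-formula n ABC h3)
    (alpha-formula (suc n) none g0) (alpha-formula (suc n) A g1) (alpha-formula (suc n) AB g2) (alpha-formula (suc n) ABC g3)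
  where
  none = corners₃ false false false
  A    = corners₃ true  false false
  AB   = corners₃ true  true  false
  ABC  = corners₃ true  true  true
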